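{- Let $G=(V,E)$ be an undirected simple graph and $c: V\to\mathbb{Z}_6$ a coloring. Let $G'=(V,E')$ be the directed graph in which $(u,v)\in E'$ if and only if there exists $w\in V$ with $\{u,w\},\{w,v\}\in E$ and $c(u)+2 \equiv c(w)+1 \equiv c(v) \pmod 6$. Then $G'$ contains a directed triangle if and only if $G$ contains a $6$-cycle that is colored correctly.
   Context: A $6$-cycle of $G$ is colored correctly if its nodes can be labeled $u_0,u_1,\dots,u_5$ in cyclic order so that $c(u_i)=i$ for each $i=0,\dots,5$. A directed triangle in $G'$ is a triple of distinct nodes $v_1,v_2,v_3$ with $(v_1,v_2),(v_2,v_3),(v_3,v_1)\in E'$. -}

module Defs where

open import Data.Nat using (ℕ; _+_)
open import Data.Nat.DivMod using (_mod_)
open import Data.Fin using (Fin; toℕ; zero; suc)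
open import Data.Product using (_×_; Σ-syntax; ∃-syntax)
open import Relation.Binary.PropositionalEquality using (_≡_; _≢_)
open import Relation.Nullary using (¬_)
open import Level using (Level; _⊔_)

ℤ₆ : Set
ℤ₆ = Fin 6

_+₆_ : ℤ₆ → ℤ₆ → ℤ₆
a +₆ b = (toℕ a + toℕ b) mod 6

[_]₆ : ℕ → ℤ₆
[ k ]₆ = k mod 6

record SimpleGraph {a b : Level} (V : Set a) : Set (a ⊔ Level.suc b) where
  field
    Adj       : V → V → Set b
    symmetric : ∀ {u v} → Adj u v → Adj v u
    loopless  : ∀ {u} → ¬ Adj u u

open SimpleGraph public

module _ {a b : Level} {V : Set a} (G : SimpleGraph {a} {b} V) (c : V → ℤ₆) where

  Arc : V → V → Set (a ⊔ b)
  Arc u v = ∃[ w ] (Adj G u w × Adj G w v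
                    × (c u +₆ [ 2 ]₆ ≡ c w +₆ [ 1 ]₆)
                    × (c w +₆ [ 1 ]₆ ≡ c v))

  HasDirectedTriangle : Set (a ⊔ b)
  HasDirectedTriangle =
    ∃[ v₁ ] ∃[ v₂ ] ∃[ v₃ ]
      ((v₁ ≢ v₂) × (v₂ ≢ v₃) × (v₁ ≢ v₃)
       × Arc v₁ v₂ × Arc v₂ v₃ × Arc v₃ v₁)

  HasCorrectlyColored6Cycle : Set (a ⊔ b)
  HasCorrectlyColored6Cycle =
    Σ[ u ∈ (ℤ₆ → V) ]
      ((∀ i j → u i ≡ u j → i ≡ j)
       × (∀ i → Adj G (u i) (u (i +₆ [ 1 ]₆)))
       × (∀ i → c (u i) ≡ i))

{-# OPTIONS --safe #-}
-- Colours strictly increase by one along every arc path u → w → v of G' (c u + 2 ≡ c w + 1 ≡ c v), so a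
-- directed triangle unfolds into a closed walk of length six in G along which the colour goes up by one
-- at each step. Such a walk visits the six colours exactly once, so after rotating the indices by the
-- colour of its starting node it is a correctly coloured 6-cycle. Conversely the even-indexed nodes of a
-- correctly coloured 6-cycle form a directed triangle, the odd ones serving as the middle nodes.
module Submission where

open import Defs
open import Level using (Level)
open import Function.Base using (_∘_)
open import Function.Bundles using (_⇔_; mk⇔)
open import Data.Nat using (_∸_)
open import Data.Fin using (toℕ; zero; suc; #_)
open import Data.Fin.Properties using (_≟_; all?)
open import Data.Product using (_×_; _,_; proj₁; Σ-syntax)
open import Relation.Binary.PropositionalEquality
open import Relation.Nullary.Decidable using (from-yes; _→-dec_)

_-₆_ : ℤ₆ → ℤ₆ → ℤ₆
i -₆ k = i +₆ [ 6 ∸ toℕ k ]₆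

+₆-assoc : ∀ x y z → (x +₆ y) +₆ z ≡ x +₆ (y +₆ z)
+₆-assoc = from-yes (all? λ x → all? λ y → all? λ z → (x +₆ y) +₆ z ≟ x +₆ (y +₆ z))

+₆-identityʳ : ∀ x → x +₆ zero ≡ x
+₆-identityʳ = from-yes (all? λ x → x +₆ zero ≟ x)

+₆-cancelʳ : ∀ x y z → x +₆ z ≡ y +₆ z → x ≡ y
+₆-cancelʳ = from-yes (all? λ x → all? λ y → all? λ z → (x +₆ z ≟ y +₆ z) →-dec (x ≟ y))

k+₆[i-₆k]≡i : ∀ k i → k +₆ (i -₆ k) ≡ i
k+₆[i-₆k]≡i = from-yes (all? λ k → all? λ i → k +₆ (i -₆ k) ≟ i)

[i+₆j]-₆k≡[i-₆k]+₆j : ∀ i j k → (i +₆ j) -₆ k ≡ (i -₆ k) +₆ j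
[i+₆j]-₆k≡[i-₆k]+₆j = from-yes (all? λ i → all? λ j → all? λ k → (i +₆ j) -₆ k ≟ (i -₆ k) +₆ j)

suc₆ : ℤ₆ → ℤ₆
suc₆ i = i +₆ [ 1 ]₆

suc₆-commuting⇒translation : (f : ℤ₆ → ℤ₆) → (∀ j → f (suc₆ j) ≡ suc₆ (f j)) →
                                  ∀ j → f j ≡ f zero +₆ j
suc₆-commuting⇒translation f f-suc = λ where
    zero → t₀
    (suc zero) → t₁
    (suc (suc zero)) → t₂
    (suc (suc (suc zero))) → t₃
    (suc (suc (suc (suc zero)))) → t₄
    (suc (suc (suc (suc (suc zero))))) → t₅
  where
  step : ∀ j → f j ≡ f zero +₆ j → f (suc₆ j) ≡ f zero +₆ suc₆ j
  step j fj = trans (f-suc j) (trans (cong suc₆ fj) (+₆-assoc (f zero) j [ 1 ]₆))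

  t₀ : f (# 0) ≡ f zero +₆ (# 0)
  t₀ = sym (+₆-identityʳ (f zero))
  t₁ : f (# 1) ≡ f zero +₆ (# 1)
  t₁ = step (# 0) t₀
  t₂ : f (# 2) ≡ f zero +₆ (# 2)
  t₂ = step (# 1) t₁
  t₃ : f (# 3) ≡ f zero +₆ (# 3)
  t₃ = step (# 2) t₂
  t₄ : f (# 4) ≡ f zero +₆ (# 4)
  t₄ = step (# 3) t₃
  t₅ : f (# 5) ≡ f zero +₆ (# 5)
  t₅ = step (# 4) t₄

module _ {a b : Level} {V : Set a} (G : SimpleGraph {a} {b} V) (c : V → ℤ₆) where

  IsAscendingHexagon : (ℤ₆ → V) → Set b
  IsAscendingHexagon n = (∀ j → Adj G (n j) (n (suc₆ j))) × (∀ j → c (n (suc₆ j)) ≡ suc₆ (c (n j)))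

  ascendingHexagon⇒correctlyColored6Cycle : (n : ℤ₆ → V) → IsAscendingHexagon n →
                                            HasCorrectlyColored6Cycle G c
  ascendingHexagon⇒correctlyColored6Cycle n (adj , asc) = u , u-injective , u-adj , u-colour
    where
    k : ℤ₆
    k = c (n zero)

    u : ℤ₆ → V
    u i = n (i -₆ k)

    u-colour : ∀ i → c (u i) ≡ i
    u-colour i = trans (suc₆-commuting⇒translation (c ∘ n) asc (i -₆ k)) (k+₆[i-₆k]≡i k i)

    u-injective : ∀ i j → u i ≡ u j → i ≡ j
    u-injective i j ui≡uj = trans (sym (u-colour i)) (trans (cong c ui≡uj) (u-colour j))

    u-adj : ∀ i → Adj G (u i) (u (suc₆ i))
    u-adj i = subst (λ x → Adj G (u i) (n x)) (sym ([i+₆j]-₆k≡[i-₆k]+₆j i [ 1 ]₆ k)) (adj (i -₆ k))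

  midpoint-colour : ∀ {u v} (arc : Arc G c u v) → c (proj₁ arc) ≡ suc₆ (c u)
  midpoint-colour {u} (w , _ , _ , cu+2≡cw+1 , _) =
    +₆-cancelʳ (c w) (suc₆ (c u)) [ 1 ]₆ (trans (sym cu+2≡cw+1) (sym (+₆-assoc (c u) [ 1 ]₆ [ 1 ]₆)))

  triangle⇒ascendingHexagon : HasDirectedTriangle G c → Σ[ n ∈ (ℤ₆ → V) ] IsAscendingHexagon n
  triangle⇒ascendingHexagon
    (v₁ , v₂ , v₃ , _ , _ , _ , arc₁@(w₁ , a₁ , b₁ , _ , d₁) , arc₂@(w₂ , a₂ , b₂ , _ , d₂)
                              , arc₃@(w₃ , a₃ , b₃ , _ , d₃)) = n , adj , asc
    where
    n : ℤ₆ → V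
    n zero = v₁
    n (suc zero) = w₁
    n (suc (suc zero)) = v₂
    n (suc (suc (suc zero))) = w₂
    n (suc (suc (suc (suc zero)))) = v₃
    n (suc (suc (suc (suc (suc zero))))) = w₃

    adj : ∀ j → Adj G (n j) (n (suc₆ j))
    adj zero = a₁
    adj (suc zero) = b₁
    adj (suc (suc zero)) = a₂
    adj (suc (suc (suc zero))) = b₂
    adj (suc (suc (suc (suc zero)))) = a₃
    adj (suc (suc (suc (suc (suc zero))))) = b₃

    asc : ∀ j → c (n (suc₆ j)) ≡ suc₆ (c (n j))
    asc zero = midpoint-colour arc₁
    asc (suc zero) = sym d₁
    asc (suc (suc zero)) = midpoint-colour arc₂
    asc (suc (suc (suc zero))) = sym d₂
    asc (suc (suc (suc (suc zero)))) = midpoint-colour arc₃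
    asc (suc (suc (suc (suc (suc zero))))) = sym d₃

  arc-skipping-one : (u : ℤ₆ → V) → (∀ i → Adj G (u i) (u (suc₆ i))) → (∀ i → c (u i) ≡ i) →
                     ∀ i → Arc G c (u i) (u (suc₆ (suc₆ i)))
  arc-skipping-one u u-adj u-colour i =
    u (suc₆ i) , u-adj i , u-adj (suc₆ i) ,
    trans (cong (_+₆ [ 2 ]₆) (u-colour i))
          (trans (sym (+₆-assoc i [ 1 ]₆ [ 1 ]₆)) (cong suc₆ (sym (u-colour (suc₆ i))))) ,
    trans (cong suc₆ (u-colour (suc₆ i))) (sym (u-colour (suc₆ (suc₆ i))))

  correctlyColored6Cycle⇒triangle : HasCorrectlyColored6Cycle G c → HasDirectedTriangle G c
  correctlyColored6Cycle⇒triangle (u , u-injective , u-adj , u-colour) =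
    u i₀ , u i₂ , u i₄ ,
    (λ e → case₀₂ (u-injective i₀ i₂ e)) , (λ e → case₂₄ (u-injective i₂ i₄ e)) ,
    (λ e → case₀₄ (u-injective i₀ i₄ e)) ,
    arc i₀ , arc i₂ , arc i₄
    where
    arc : ∀ i → Arc G c (u i) (u (suc₆ (suc₆ i)))
    arc = arc-skipping-one u u-adj u-colour

    i₀ i₂ i₄ : ℤ₆
    i₀ = # 0
    i₂ = # 2
    i₄ = # 4
    case₀₂ : i₀ ≢ i₂
    case₀₂ ()
    case₂₄ : i₂ ≢ i₄
    case₂₄ ()
    case₀₄ : i₀ ≢ i₄
    case₀₄ ()

claim32 : ∀ {a b : Level} {V : Set a} (G : SimpleGraph {a} {b} V) (c : V → ℤ₆) →
    HasDirectedTriangle G c ⇔ HasCorrectlyColored6Cycle G c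
claim32 G c = mk⇔
  (λ triangle → let (n , hexagon) = triangle⇒ascendingHexagon G c triangle
                in ascendingHexagon⇒correctlyColored6Cycle G c n hexagon)
  (correctlyColored6Cycle⇒triangle G c)
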